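{- Let $q\ge1$ and let $f_n$ be the number of $q$-decreasing binary words of length $n$. Then $$\sum_{n\ge0}f_nx^n=\frac{1-x^{q+1}}{1-2x+x^{q+2}}.$$
   Context: A binary word is $q$-decreasing ($q\ge1$) if each of its maximal factors (maximal blocks of consecutive letters) of the form $0^a1^b$ with $a>0$ satisfies $q\cdot a>b$. -}

module Defs where

open import Data.Bool using (Bool; true; false)
open import Data.Nat using (ℕ; zero; suc; _+_; _*_; _∸_; _<_; _≡ᵇ_)
open import Data.Integer as ℤ using (ℤ; +_)
open import Data.List using (List; []; _∷_; _++_; replicate; length; map; sum; upTo)
open import Data.List.Membership.Propositional using (_∈_)
open import Data.List.Relation.Unary.Unique.Propositional using (Unique)
open import Data.Product using (Σ; ∃; ∃-syntax; _×_)
open import Relation.Binary.PropositionalEquality using (_≡_; _≢_)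
open import Relation.Nullary using (¬_)
open import Function.Bundles using (_⇔_)

-- Binary words: the letter 0 is 'false', the letter 1 is 'true'.
Word : Set
Word = List Bool

block : ℕ → ℕ → Word
block a b = replicate a false ++ replicate b true

IsBlockForm : Word → Set
IsBlockForm s = ∃[ a ] ∃[ b ] (s ≡ block a b)

MaximalOcc : Word → Word → Word → Set
MaximalOcc u s v =
  ∀ (u' x y v' : Word) → u ≡ u' ++ x → v ≡ y ++ v' → x ++ y ≢ [] →
  ¬ IsBlockForm (x ++ s ++ y)

QDecreasing : ℕ → Word → Set
QDecreasing q w =
  ∀ (u v : Word) (a b : ℕ) → 0 < a → w ≡ u ++ block a b ++ v →
  MaximalOcc u (block a b) v → b < q * a

IsCountQDec : ℕ → ℕ → ℕ → Set
IsCountQDec q n k =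
  Σ (List Word) λ L → Unique L × (∀ w → (w ∈ L) ⇔ (length w ≡ n × QDecreasing q w))
                    × length L ≡ k

Series : Set
Series = ℕ → ℤ

sumℤ : List ℤ → ℤ
sumℤ []       = + 0
sumℤ (x ∷ xs) = x ℤ.+ sumℤ xs

_⊛_ : Series → Series → Series
(F ⊛ G) n = sumℤ (map (λ i → F i ℤ.* G (n ∸ i)) (upTo (suc n)))

mono : ℕ → Series
mono m n with m ≡ᵇ n
... | true  = + 1
... | false = + 0

denom : ℕ → Series
denom q n = mono 0 n ℤ.- (+ 2) ℤ.* mono 1 n ℤ.+ mono (q + 2) n

numer : ℕ → Series
numer q n = mono 0 n ℤ.- mono (q + 1) n

module Submission where

-- A word is q-decreasing iff the left-to-right scan that remembers only the
-- factor 0^a 1^b (a ≥ 1) the input currently ends with never lets b reach q·a: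
-- the maximal factors with a > 0 are exactly the factors this scan builds.
-- Let f n count the accepted words of length n and s n those ending in a
-- saturated factor 0^a 1^(qa−1), which one more 1 would spoil; appending a
-- letter gives f (n + 1) = 2 f n − s n. The words ending in the state 0^a 1^b
-- are as many as the words of length n − a − b after which a 0 opens a new
-- factor, and the saturated factor gets q + 1 letters longer from a to a + 1;
-- summing over a yields s (n + q + 1) = f n, s q = 1 and s n = 0 for n < q.
-- As series s = x^q + x^(q+1) f, and the recurrence becomes
-- f · (1 − 2x + x^(q+2)) = 1 − x^(q+1).

open import Data.Bool using (Bool; true; false; T; _∧_)
open import Data.Bool.Properties using (∧-zeroʳ)
open import Data.Empty using (⊥; ⊥-elim)
open import Data.Integer as ℤ using (ℤ; +_; _-_; -_)
import Data.Integer.Properties as ℤₚ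
import Data.Integer.Tactic.RingSolver as ℤ-Solver
open import Data.List
  using (List; []; _∷_; _++_; [_]; _∷ʳ_; length; map; replicate; foldl; upTo; applyUpTo; initLast; _∷ʳ′_)
open import Data.List.Properties
  using (length-++; length-map; length-replicate; ++-assoc; ++-identityʳ; ∷-injectiveʳ;
         ∷ʳ-injectiveˡ; ∷ʳ-injectiveʳ;
         foldl-++; foldl-∷ʳ; map-cong; map-upTo)
open import Data.List.Membership.Propositional using (_∈_)
open import Data.List.Membership.Propositional.Properties
  using (∈-map⁺; ∈-map⁻; ∈-++⁺ˡ; ∈-++⁺ʳ; ∈-++⁻)
open import Data.List.Membership.Propositional.Properties.WithK using (unique∧set⇒bag)
open import Data.List.Relation.Binary.BagAndSetEquality using (∼bag⇒↭)
open import Data.List.Relation.Binary.Permutation.Propositional.Properties using (↭-length)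
import Data.List.Relation.Unary.All as All
open import Data.List.Relation.Unary.AllPairs using ([]; _∷_)
open import Data.List.Relation.Unary.Any using (here)
open import Data.List.Relation.Unary.Unique.Propositional using (Unique)
import Data.List.Relation.Unary.Unique.Propositional.Properties as Unique
open import Data.Maybe using (Maybe; just; nothing; is-just)
open import Data.Nat
  using (ℕ; zero; suc; _+_; _*_; _∸_; _<_; _≤_; s≤s; z≤n; s≤s⁻¹; _≡ᵇ_; _<?_; _≤?_; _≟_)
open import Data.Nat.Properties
open import Data.Nat.Tactic.RingSolver using (solve-∀)
open import Algebra.Properties.CommutativeSemigroup +-commutativeSemigroup using (interchange; xy∙z≈xz∙y)
open import Data.Product using (_×_; _,_; ∃-syntax)
open import Data.Sum as Sum using ([_,_]′)
open import Data.Unit using (tt)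
open import Defs
open import Function.Base using (_∘_)
open import Function.Bundles using (_⇔_; Equivalence; mk⇔)
open import Relation.Binary.Definitions using (tri<; tri≈; tri>)
open import Relation.Binary.PropositionalEquality hiding ([_])
open import Relation.Nullary using (¬_; yes; no; does)
open import Relation.Nullary.Decidable using (dec-true; dec-false)

-- Sums over words and lists of words

length-∷ʳ : ∀ {A : Set} (xs : List A) x → length (xs ∷ʳ x) ≡ suc (length xs)
length-∷ʳ xs x = trans (length-++ xs) (+-comm (length xs) 1)

length-∷ʳ⁻ : ∀ {A : Set} (xs : List A) {x n} → length (xs ∷ʳ x) ≡ suc n → length xs ≡ n
length-∷ʳ⁻ xs {x} |xs∷ʳx| = suc-injective (trans (sym (length-∷ʳ xs x)) |xs∷ʳx|)

length-unique-≡ : ∀ {A : Set} {xs ys : List A} → Unique xs → Unique ys →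
                  (∀ {x} → (x ∈ xs) ⇔ (x ∈ ys)) → length xs ≡ length ys
length-unique-≡ ux uy xs⇔ys = ↭-length (∼bag⇒↭ (unique∧set⇒bag ux uy xs⇔ys))

-- Words are built by appending letters on the right, as an automaton reads them.
sumWords : (Word → ℕ) → ℕ → ℕ
sumWords φ zero    = φ []
sumWords φ (suc n) = sumWords (φ ∘ (_∷ʳ false)) n + sumWords (φ ∘ (_∷ʳ true)) n

sumWords-cong : ∀ n {φ ψ : Word → ℕ} → (∀ w → length w ≡ n → φ w ≡ ψ w) →
                sumWords φ n ≡ sumWords ψ n
sumWords-cong zero    φ≡ψ = φ≡ψ [] refl
sumWords-cong (suc n) {φ} {ψ} φ≡ψ =
  cong₂ _+_ (sumWords-cong n (appended false)) (sumWords-cong n (appended true))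
  where
  appended : ∀ x w → length w ≡ n → φ (w ∷ʳ x) ≡ ψ (w ∷ʳ x)
  appended x w |w| = φ≡ψ (w ∷ʳ x) (trans (length-∷ʳ w x) (cong suc |w|))

sumWords-+ : ∀ n (φ ψ : Word → ℕ) → sumWords (λ w → φ w + ψ w) n ≡ sumWords φ n + sumWords ψ n
sumWords-+ zero    φ ψ = refl
sumWords-+ (suc n) φ ψ =
  trans (cong₂ _+_ (sumWords-+ n (φ ∘ (_∷ʳ false)) (ψ ∘ (_∷ʳ false)))
                   (sumWords-+ n (φ ∘ (_∷ʳ true)) (ψ ∘ (_∷ʳ true))))
        (interchange (sumWords (φ ∘ (_∷ʳ false)) n) _ _ _)

sumWords-zero : ∀ n → sumWords (λ _ → 0) n ≡ 0
sumWords-zero zero    = refl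
sumWords-zero (suc n) = cong₂ _+_ (sumWords-zero n) (sumWords-zero n)

sumBelow : (ℕ → ℕ) → ℕ → ℕ
sumBelow g zero    = 0
sumBelow g (suc N) = g 0 + sumBelow (g ∘ suc) N

sumBelow-cong : ∀ N {g h : ℕ → ℕ} → (∀ i → g i ≡ h i) → sumBelow g N ≡ sumBelow h N
sumBelow-cong zero    g≡h = refl
sumBelow-cong (suc N) g≡h = cong₂ _+_ (g≡h 0) (sumBelow-cong N (g≡h ∘ suc))

sumBelow-zero : ∀ N {g : ℕ → ℕ} → (∀ i → g i ≡ 0) → sumBelow g N ≡ 0
sumBelow-zero zero    g≡0 = refl
sumBelow-zero (suc N) g≡0 = cong₂ _+_ (g≡0 0) (sumBelow-zero N (g≡0 ∘ suc))

sumBelow-single : ∀ N {j} (g : ℕ → ℕ) → j < N → (∀ i → i ≢ j → g i ≡ 0) → sumBelow g N ≡ g j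
sumBelow-single (suc N) {zero}  g _ g≡0 =
  trans (cong (_+_ (g 0)) (sumBelow-zero N (λ i → g≡0 (suc i) λ ()))) (+-identityʳ (g 0))
sumBelow-single (suc N) {suc j} g (s≤s j<N) g≡0 =
  cong₂ _+_ (g≡0 0 λ ()) (sumBelow-single N (g ∘ suc) j<N λ i i≢j → g≡0 (suc i) (i≢j ∘ suc-injective))

sumWords-sumBelow : ∀ N n (φ : ℕ → Word → ℕ) →
                    sumWords (λ w → sumBelow (λ i → φ i w) N) n ≡ sumBelow (λ i → sumWords (φ i) n) N
sumWords-sumBelow zero    n φ = sumWords-zero n
sumWords-sumBelow (suc N) n φ =
  trans (sumWords-+ n (φ 0) _) (cong (_+_ (sumWords (φ 0) n)) (sumWords-sumBelow N n (φ ∘ suc)))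

indicator : Bool → ℕ
indicator true  = 1
indicator false = 0

wordsSatisfying : (Word → Bool) → ℕ → List Word
wordsSatisfying P zero with P []
... | true  = [] ∷ []
... | false = []
wordsSatisfying P (suc n) =
  map (_∷ʳ false) (wordsSatisfying (P ∘ (_∷ʳ false)) n) ++
  map (_∷ʳ true)  (wordsSatisfying (P ∘ (_∷ʳ true)) n)

length-wordsSatisfying : ∀ n P → length (wordsSatisfying P n) ≡ sumWords (indicator ∘ P) n
length-wordsSatisfying zero P with P []
... | true  = refl
... | false = refl
length-wordsSatisfying (suc n) P = begin
  length (map (_∷ʳ false) W₀ ++ map (_∷ʳ true) W₁)
    ≡⟨ length-++ (map (_∷ʳ false) W₀) ⟩
  length (map (_∷ʳ false) W₀) + length (map (_∷ʳ true) W₁)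
    ≡⟨ cong₂ _+_ (length-map _ W₀) (length-map _ W₁) ⟩
  length W₀ + length W₁
    ≡⟨ cong₂ _+_ (length-wordsSatisfying n _) (length-wordsSatisfying n _) ⟩
  sumWords (indicator ∘ P) (suc n)
    ∎
  where
  open ≡-Reasoning
  W₀ W₁ : List Word
  W₀ = wordsSatisfying (P ∘ (_∷ʳ false)) n
  W₁ = wordsSatisfying (P ∘ (_∷ʳ true)) n

∈-wordsSatisfying⁻ : ∀ n P {w} → w ∈ wordsSatisfying P n → length w ≡ n × P w ≡ true
∈-wordsSatisfying⁻ zero P w∈ with P [] in P[]
∈-wordsSatisfying⁻ zero P (here refl) | true = refl , P[]
∈-wordsSatisfying⁻ (suc n) P w∈ =
  [ appended false , appended true ]′ (Sum.map (∈-map⁻ _) (∈-map⁻ _) (∈-++⁻ (map (_∷ʳ false) _) w∈))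
  where
  appended : ∀ x {w} → ∃[ v ] v ∈ wordsSatisfying (P ∘ (_∷ʳ x)) n × w ≡ v ∷ʳ x →
             length w ≡ suc n × P w ≡ true
  appended x (v , v∈ , refl) with ∈-wordsSatisfying⁻ n _ v∈
  ... | |v| , Pv = trans (length-∷ʳ v x) (cong suc |v|) , Pv

∈-wordsSatisfying⁺ : ∀ n P {w} → length w ≡ n → P w ≡ true → w ∈ wordsSatisfying P n
∈-wordsSatisfying⁺ zero    P {[]} _ P[] rewrite P[] = here refl
∈-wordsSatisfying⁺ (suc n) P {w} |w| Pw with initLast w
... | v ∷ʳ′ false = ∈-++⁺ˡ (∈-map⁺ _ (∈-wordsSatisfying⁺ n _ (length-∷ʳ⁻ v |w|) Pw))
... | v ∷ʳ′ true  = ∈-++⁺ʳ _ (∈-map⁺ _ (∈-wordsSatisfying⁺ n _ (length-∷ʳ⁻ v |w|) Pw))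

wordsSatisfying-unique : ∀ n P → Unique (wordsSatisfying P n)
wordsSatisfying-unique zero P with P []
... | true  = All.[] ∷ []
... | false = []
wordsSatisfying-unique (suc n) P =
  Unique.++⁺ (Unique.map⁺ (∷ʳ-injectiveˡ _ _) (wordsSatisfying-unique n _))
             (Unique.map⁺ (∷ʳ-injectiveˡ _ _) (wordsSatisfying-unique n _))
             λ (∈₀ , ∈₁) → last-differs (∈-map⁻ _ ∈₀) (∈-map⁻ _ ∈₁)
  where
  last-differs : ∀ {w} {U V : List Word} →
                 ∃[ u ] (u ∈ U × w ≡ u ∷ʳ false) → ∃[ v ] (v ∈ V × w ≡ v ∷ʳ true) → ⊥
  last-differs (u , _ , refl) (v , _ , eq) with () ← ∷ʳ-injectiveʳ u v eq

-- Coefficients of products of series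

sumℤ-applyUpTo-zero : ∀ N (g : ℕ → ℤ) → (∀ i → i < N → g i ≡ + 0) → sumℤ (applyUpTo g N) ≡ + 0
sumℤ-applyUpTo-zero zero    g g≡0 = refl
sumℤ-applyUpTo-zero (suc N) g g≡0 =
  cong₂ ℤ._+_ (g≡0 0 (s≤s z≤n)) (sumℤ-applyUpTo-zero N (g ∘ suc) λ i i<N → g≡0 (suc i) (s≤s i<N))

sumℤ-applyUpTo-single : ∀ N (g : ℕ → ℤ) {j} → j < N → (∀ i → i < N → i ≢ j → g i ≡ + 0) →
                        sumℤ (applyUpTo g N) ≡ g j
sumℤ-applyUpTo-single (suc N) g {zero} _ g≡0 =
  trans (cong (ℤ._+_ (g 0)) (sumℤ-applyUpTo-zero N (g ∘ suc) λ i i<N → g≡0 (suc i) (s≤s i<N) λ ()))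
        (ℤₚ.+-identityʳ (g 0))
sumℤ-applyUpTo-single (suc N) g {suc j} (s≤s j<N) g≡0 =
  trans (cong₂ ℤ._+_ (g≡0 0 (s≤s z≤n) λ ()) (sumℤ-applyUpTo-single N (g ∘ suc) j<N elsewhere))
        (ℤₚ.+-identityˡ (g (suc j)))
  where
  elsewhere : ∀ i → i < N → i ≢ j → g (suc i) ≡ + 0
  elsewhere i i<N i≢j = g≡0 (suc i) (s≤s i<N) (i≢j ∘ suc-injective)

mono-≡ : ∀ m → mono m m ≡ + 1
mono-≡ m with m ≡ᵇ m in eq
... | true  = refl
... | false with () ← subst T eq (≡⇒≡ᵇ m m refl)

mono-≢ : ∀ m n → m ≢ n → mono m n ≡ + 0
mono-≢ m n m≢n with m ≡ᵇ n in eq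
... | false = refl
... | true  = ⊥-elim (m≢n (≡ᵇ⇒≡ m n (subst T (sym eq) tt)))

mono-suc : ∀ m n → mono (suc m) (suc n) ≡ mono m n
mono-suc m n with m ≟ n
... | yes refl = trans (mono-≡ (suc m)) (sym (mono-≡ m))
... | no m≢n   = trans (mono-≢ (suc m) (suc n) (m≢n ∘ suc-injective)) (sym (mono-≢ m n m≢n))

ofℕ : (ℕ → ℕ) → Series
ofℕ f k = + f k

⊛-applyUpTo : ∀ F G n → (F ⊛ G) n ≡ sumℤ (applyUpTo (λ i → F i ℤ.* G (n ∸ i)) (suc n))
⊛-applyUpTo F G n = cong sumℤ (map-upTo (λ i → F i ℤ.* G (n ∸ i)) (suc n))

⊛-congˡ : ∀ {F G : Series} H n → (∀ k → F k ≡ G k) → (F ⊛ H) n ≡ (G ⊛ H) n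
⊛-congˡ H n F≡G = cong sumℤ (map-cong (λ i → cong (ℤ._* H (n ∸ i)) (F≡G i)) (upTo (suc n)))

⊛-mono-≤ : ∀ F {m n} → m ≤ n → (F ⊛ mono m) n ≡ F (n ∸ m)
⊛-mono-≤ F {m} {n} m≤n = begin
  (F ⊛ mono m) n
    ≡⟨ ⊛-applyUpTo F (mono m) n ⟩
  sumℤ (applyUpTo term (suc n))
    ≡⟨ sumℤ-applyUpTo-single (suc n) term (s≤s (m∸n≤m n m)) elsewhere ⟩
  F (n ∸ m) ℤ.* mono m (n ∸ (n ∸ m))
    ≡⟨ cong (λ k → F (n ∸ m) ℤ.* mono m k) (m∸[m∸n]≡n m≤n) ⟩
  F (n ∸ m) ℤ.* mono m m
    ≡⟨ cong (F (n ∸ m) ℤ.*_) (mono-≡ m) ⟩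
  F (n ∸ m) ℤ.* + 1
    ≡⟨ ℤₚ.*-identityʳ (F (n ∸ m)) ⟩
  F (n ∸ m)
    ∎
  where
  open ≡-Reasoning
  term : ℕ → ℤ
  term i = F i ℤ.* mono m (n ∸ i)
  elsewhere : ∀ i → i < suc n → i ≢ n ∸ m → term i ≡ + 0
  elsewhere i i<1+n i≢n∸m = trans (cong (F i ℤ.*_) (mono-≢ m (n ∸ i) λ m≡n∸i →
      i≢n∸m (trans (sym (m∸[m∸n]≡n (s≤s⁻¹ i<1+n))) (cong (n ∸_) (sym m≡n∸i)))))
    (ℤₚ.*-zeroʳ (F i))

⊛-mono-> : ∀ F {m n} → n < m → (F ⊛ mono m) n ≡ + 0
⊛-mono-> F {m} {n} n<m =
  trans (⊛-applyUpTo F (mono m) n) (sumℤ-applyUpTo-zero (suc n) (λ i → F i ℤ.* mono m (n ∸ i)) λ i _ →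
    trans (cong (F i ℤ.*_) (mono-≢ m (n ∸ i) λ m≡n∸i →
             <-irrefl (sym m≡n∸i) (≤-<-trans (m∸n≤m n i) n<m)))
          (ℤₚ.*-zeroʳ (F i)))

⊛-mono-suc : ∀ F m n → (F ⊛ mono (suc m)) (suc n) ≡ (F ⊛ mono m) n
⊛-mono-suc F m n with m ≤? n
... | yes m≤n = trans (⊛-mono-≤ F (s≤s m≤n)) (sym (⊛-mono-≤ F m≤n))
... | no m≰n  = trans (⊛-mono-> F (s≤s (≰⇒> m≰n))) (sym (⊛-mono-> F (≰⇒> m≰n)))

sumℤ-map-denom : ∀ (xs : List ℕ) (a b c : ℕ → ℤ) →
                 sumℤ (map (λ i → a i - + 2 ℤ.* b i ℤ.+ c i) xs) ≡
                 sumℤ (map a xs) - + 2 ℤ.* sumℤ (map b xs) ℤ.+ sumℤ (map c xs)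
sumℤ-map-denom []       a b c = refl
sumℤ-map-denom (x ∷ xs) a b c =
  trans (cong (ℤ._+_ (a x - + 2 ℤ.* b x ℤ.+ c x)) (sumℤ-map-denom xs a b c)) (regroup (a x) (b x) (c x) _ _ _)
  where
  regroup : ∀ a b c a′ b′ c′ → (a - + 2 ℤ.* b ℤ.+ c) ℤ.+ (a′ - + 2 ℤ.* b′ ℤ.+ c′) ≡
                               (a ℤ.+ a′) - + 2 ℤ.* (b ℤ.+ b′) ℤ.+ (c ℤ.+ c′)
  regroup = ℤ-Solver.solve-∀

⊛-denom : ∀ F q n →
          (F ⊛ denom q) n ≡ (F ⊛ mono 0) n - + 2 ℤ.* (F ⊛ mono 1) n ℤ.+ (F ⊛ mono (q + 2)) n
⊛-denom F q n =
  trans (cong sumℤ (map-cong (λ i → distrib (F i) (mono 0 (n ∸ i)) (mono 1 (n ∸ i)) (mono (q + 2) (n ∸ i)))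
                             (upTo (suc n))))
        (sumℤ-map-denom (upTo (suc n)) (term 0) (term 1) (term (q + 2)))
  where
  term : ℕ → ℕ → ℤ
  term m i = F i ℤ.* mono m (n ∸ i)
  distrib : ∀ x m₀ m₁ m₂ →
            x ℤ.* (m₀ - + 2 ℤ.* m₁ ℤ.+ m₂) ≡ x ℤ.* m₀ - + 2 ℤ.* (x ℤ.* m₁) ℤ.+ x ℤ.* m₂
  distrib = ℤ-Solver.solve-∀

shifted-series : ∀ q (f B : ℕ → ℕ) →
                 (∀ n → n < q → B n ≡ 0) → B q ≡ 1 → (∀ n → B (n + suc q) ≡ f n) →
                 ∀ n → + B n ≡ mono q n ℤ.+ (ofℕ f ⊛ mono (q + 1)) n
shifted-series q f B short at-q shift n with <-cmp n q
... | tri< n<q _ _ = trans (cong +_ (short n n<q)) (sym (cong₂ ℤ._+_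
      (mono-≢ q n λ q≡n → <-irrefl (sym q≡n) n<q) (⊛-mono-> (ofℕ f) (≤-trans n<q (m≤m+n q 1)))))
... | tri≈ _ refl _ =
      trans (cong +_ at-q) (sym (cong₂ ℤ._+_ (mono-≡ n) (⊛-mono-> (ofℕ f) (m<m+n n (s≤s z≤n)))))
... | tri> _ _ q<n with k , refl ← m≤n⇒∃[o]m+o≡n q<n = begin
  + B (suc q + k)
    ≡⟨ cong (+_ ∘ B) (+-comm (suc q) k) ⟩
  + B (k + suc q)
    ≡⟨ cong +_ (shift k) ⟩
  + f k
    ≡⟨ cong (+_ ∘ f) (m+n∸m≡n (q + 1) k) ⟨
  + f (q + 1 + k ∸ (q + 1))
    ≡⟨ cong (λ i → + f (i + k ∸ (q + 1))) (+-comm q 1) ⟩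
  + f (suc q + k ∸ (q + 1))
    ≡⟨ ⊛-mono-≤ (ofℕ f) q+1≤n ⟨
  (ofℕ f ⊛ mono (q + 1)) (suc q + k)
    ≡⟨ ℤₚ.+-identityˡ _ ⟨
  + 0 ℤ.+ (ofℕ f ⊛ mono (q + 1)) (suc q + k)
    ≡⟨ cong (ℤ._+ (ofℕ f ⊛ mono (q + 1)) (suc q + k)) (mono-≢ q (suc q + k) (m≢1+m+n q)) ⟨
  mono q (suc q + k) ℤ.+ (ofℕ f ⊛ mono (q + 1)) (suc q + k)
    ∎
  where
  open ≡-Reasoning
  q+1≤n : q + 1 ≤ suc q + k
  q+1≤n = ≤-trans (≤-reflexive (+-comm q 1)) (m≤m+n (suc q) k)

recurrence-ℤ : ∀ x y b → x + b ≡ y + y → + x - + 2 ℤ.* + y ≡ - + b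
recurrence-ℤ x y b x+b≡y+y = begin
  + x - + 2 ℤ.* + y
    ≡⟨ regroup (+ x) (+ y) (+ b) ⟩
  ((+ x ℤ.+ + b) - (+ y ℤ.+ + y)) - + b
    ≡⟨ cong₂ (λ s t → (s - t) - + b) (ℤₚ.pos-+ x b) (ℤₚ.pos-+ y y) ⟨
  (+ (x + b) - + (y + y)) - + b
    ≡⟨ cong (λ s → (+ s - + (y + y)) - + b) x+b≡y+y ⟩
  (+ (y + y) - + (y + y)) - + b
    ≡⟨ cong (_- + b) (ℤₚ.+-inverseʳ (+ (y + y))) ⟩
  + 0 - + b
    ≡⟨ ℤₚ.+-identityˡ (- + b) ⟩
  - + b
    ∎
  where
  open ≡-Reasoning
  regroup : ∀ x y b → x - + 2 ℤ.* y ≡ ((x ℤ.+ b) - (y ℤ.+ y)) - b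
  regroup = ℤ-Solver.solve-∀

denom-cong : ∀ {a a′ b b′ c c′ : ℤ} → a ≡ a′ → b ≡ b′ → c ≡ c′ →
             a - + 2 ℤ.* b ℤ.+ c ≡ a′ - + 2 ℤ.* b′ ℤ.+ c′
denom-cong refl refl refl = refl

series-from-recurrence : ∀ q (f B : ℕ → ℕ) → f 0 ≡ 1 → (∀ n → f (suc n) + B n ≡ f n + f n) →
                         (∀ n → + B n ≡ mono q n ℤ.+ (ofℕ f ⊛ mono (q + 1)) n) →
                         ∀ n → (ofℕ f ⊛ denom q) n ≡ numer q n
series-from-recurrence q f B f0≡1 recurrence B≡ zero = begin
  (F ⊛ denom q) 0
    ≡⟨ ⊛-denom F q 0 ⟩
  (F ⊛ mono 0) 0 - + 2 ℤ.* (F ⊛ mono 1) 0 ℤ.+ (F ⊛ mono (q + 2)) 0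
    ≡⟨ denom-cong (⊛-mono-≤ F z≤n) (⊛-mono-> F {1} {0} (s≤s z≤n)) (⊛-mono-> F 0<q+2) ⟩
  + f 0 - + 2 ℤ.* + 0 ℤ.+ + 0
    ≡⟨ cong (λ a → + a - + 2 ℤ.* + 0 ℤ.+ + 0) f0≡1 ⟩
  + 1 - + 0
    ≡⟨ cong (_-_ (+ 1)) (mono-≢ (q + 1) 0 q+1≢0) ⟨
  numer q 0
    ∎
  where
  open ≡-Reasoning
  F : Series
  F = ofℕ f
  0<q+2 : 0 < q + 2
  0<q+2 = ≤-trans (s≤s (z≤n {1})) (m≤n+m 2 q)
  q+1≢0 : q + 1 ≢ 0
  q+1≢0 q+1≡0 = 1+n≢0 (trans (+-comm 1 q) q+1≡0)
series-from-recurrence q f B f0≡1 recurrence B≡ (suc n) = begin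
  (F ⊛ denom q) (suc n)
    ≡⟨ ⊛-denom F q (suc n) ⟩
  (F ⊛ mono 0) (suc n) - + 2 ℤ.* (F ⊛ mono 1) (suc n) ℤ.+ (F ⊛ mono (q + 2)) (suc n)
    ≡⟨ denom-cong (⊛-mono-≤ F z≤n) (⊛-mono-≤ F (s≤s z≤n)) shifted ⟩
  + f (suc n) - + 2 ℤ.* + f n ℤ.+ C
    ≡⟨ cong (ℤ._+ C) (recurrence-ℤ (f (suc n)) (f n) (B n) (recurrence n)) ⟩
  - + B n ℤ.+ C
    ≡⟨ cong (λ b → - b ℤ.+ C) (B≡ n) ⟩
  - (mono q n ℤ.+ C) ℤ.+ C
    ≡⟨ cancel (mono q n) C ⟩
  + 0 - mono q n
    ≡⟨ cong (_-_ (+ 0)) (trans (cong (λ m → mono m (suc n)) (+-comm q 1)) (mono-suc q n)) ⟨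
  numer q (suc n)
    ∎
  where
  open ≡-Reasoning
  F : Series
  F = ofℕ f
  C : ℤ
  C = (F ⊛ mono (q + 1)) n
  shifted : (F ⊛ mono (q + 2)) (suc n) ≡ C
  shifted = trans (cong (λ m → (F ⊛ mono m) (suc n)) (+-suc q 1)) (⊛-mono-suc F (q + 1) n)
  cancel : ∀ m c → - (m ℤ.+ c) ℤ.+ c ≡ + 0 - m
  cancel = ℤ-Solver.solve-∀

-- Factors 0^a 1^b

EndsIn0 : Word → Set
EndsIn0 w = ∃[ u ] w ≡ u ∷ʳ false

StartsWith1 : Word → Set
StartsWith1 w = ∃[ v ] w ≡ true ∷ v

∷ʳ-true-¬EndsIn0 : ∀ w → ¬ EndsIn0 (w ∷ʳ true)
∷ʳ-true-¬EndsIn0 w (u , eq) with () ← ∷ʳ-injectiveʳ w u eq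

replicate-∷ʳ : ∀ {A : Set} n (x : A) → replicate n x ∷ʳ x ≡ x ∷ replicate n x
replicate-∷ʳ zero    x = refl
replicate-∷ʳ (suc n) x = cong (x ∷_) (replicate-∷ʳ n x)

replicate-+ : ∀ {A : Set} m n (x : A) → replicate (m + n) x ≡ replicate m x ++ replicate n x
replicate-+ zero    n x = refl
replicate-+ (suc m) n x = cong (x ∷_) (replicate-+ m n x)

block-++-ones : ∀ a b c → block a b ++ replicate c true ≡ block a (b + c)
block-++-ones a b c = begin
  (replicate a false ++ replicate b true) ++ replicate c true
    ≡⟨ ++-assoc (replicate a false) _ _ ⟩
  replicate a false ++ replicate b true ++ replicate c true
    ≡⟨ cong (replicate a false ++_) (replicate-+ b c true) ⟨
  block a (b + c)
    ∎
  where open ≡-Reasoning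

block-∷ʳ-true : ∀ a b → block a b ∷ʳ true ≡ block a (suc b)
block-∷ʳ-true a b = trans (block-++-ones a b 1) (cong (block a) (+-comm b 1))

block-∷ʳ-false : ∀ a → block a 0 ∷ʳ false ≡ block (suc a) 0
block-∷ʳ-false a = begin
  (replicate a false ++ []) ∷ʳ false
    ≡⟨ cong (_∷ʳ false) (++-identityʳ (replicate a false)) ⟩
  replicate a false ∷ʳ false
    ≡⟨ replicate-∷ʳ a false ⟩
  replicate (suc a) false
    ≡⟨ ++-identityʳ (replicate (suc a) false) ⟨
  block (suc a) 0
    ∎
  where open ≡-Reasoning

replicate-true-¬10 : ∀ b xs ys → replicate b true ≢ xs ++ true ∷ false ∷ ys
replicate-true-¬10 (suc zero)    []       ys ()
replicate-true-¬10 (suc (suc b)) []       ys ()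
replicate-true-¬10 (suc b)       (x ∷ xs) ys eq = replicate-true-¬10 b xs ys (∷-injectiveʳ eq)

block-¬10 : ∀ a b xs ys → block a b ≢ xs ++ true ∷ false ∷ ys
block-¬10 zero    b xs       ys = replicate-true-¬10 b xs ys
block-¬10 (suc a) b []       ys ()
block-¬10 (suc a) b (x ∷ xs) ys eq = block-¬10 a b xs ys (∷-injectiveʳ eq)

IsBlockForm-¬10 : ∀ {w} xs ys → IsBlockForm w → w ≢ xs ++ true ∷ false ∷ ys
IsBlockForm-¬10 xs ys (a , b , refl) = block-¬10 a b xs ys

MaximalOcc⇒¬EndsIn0 : ∀ {u a b v} → MaximalOcc u (block (suc a) b) v → ¬ EndsIn0 u
MaximalOcc⇒¬EndsIn0 {a = a} {b} max (u′ , refl) =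
  max u′ [ false ] [] _ refl refl (λ ()) (suc (suc a) , b , cong (false ∷_) (++-identityʳ (block (suc a) b)))

block-MaximalOcc : ∀ {u a b v} → ¬ EndsIn0 u → ¬ StartsWith1 v → MaximalOcc u (block (suc a) (suc b)) v
block-MaximalOcc _ _ _ x _ _ _ _ _ _ with initLast x
block-MaximalOcc _ _ _ _ [] _ _ _ nonempty _ | [] = nonempty refl
block-MaximalOcc _ ¬1v _ _ (true ∷ y) v′ _ refl _ _ | [] = ¬1v (y ++ v′ , refl)
block-MaximalOcc {a = a} {b} _ _ _ _ (false ∷ y) _ _ _ _ blockForm | [] =
  IsBlockForm-¬10 (block (suc a) b) y blockForm (begin
    block (suc a) (suc b) ++ false ∷ y
      ≡⟨ cong (_++ false ∷ y) (block-∷ʳ-true (suc a) b) ⟨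
    (block (suc a) b ∷ʳ true) ++ false ∷ y
      ≡⟨ ++-assoc (block (suc a) b) [ true ] (false ∷ y) ⟩
    block (suc a) b ++ true ∷ false ∷ y
      ∎)
  where open ≡-Reasoning
block-MaximalOcc ¬0u _ u′ _ _ _ refl _ _ _ | x ∷ʳ′ false = ¬0u (u′ ++ x , sym (++-assoc u′ x [ false ]))
block-MaximalOcc {a = a} {b} _ _ _ _ y _ _ _ _ blockForm | x ∷ʳ′ true =
  IsBlockForm-¬10 x (block a (suc b) ++ y) blockForm (++-assoc x [ true ] _)

¬EndsIn0-[] : ¬ EndsIn0 []
¬EndsIn0-[] ([]    , ())
¬EndsIn0-[] (_ ∷ _ , ())

leadingOnes : ∀ r → ∃[ c ] ∃[ r′ ] r ≡ replicate c true ++ r′ × ¬ StartsWith1 r′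
leadingOnes (true ∷ r) with leadingOnes r
... | c , r′ , refl , ¬1r′ = suc c , r′ , refl , ¬1r′
leadingOnes []          = 0 , [] , refl , λ ()
leadingOnes (false ∷ r) = 0 , false ∷ r , refl , λ ()

++-block-++-ones : ∀ u a b c v → (u ++ block a b) ++ replicate c true ++ v ≡ u ++ block a (b + c) ++ v
++-block-++-ones u a b c v = begin
  (u ++ block a b) ++ replicate c true ++ v
    ≡⟨ ++-assoc u (block a b) _ ⟩
  u ++ block a b ++ replicate c true ++ v
    ≡⟨ cong (u ++_) (++-assoc (block a b) _ v) ⟨
  u ++ (block a b ++ replicate c true) ++ v
    ≡⟨ cong (λ z → u ++ z ++ v) (block-++-ones a b c) ⟩
  u ++ block a (b + c) ++ v
    ∎
  where open ≡-Reasoning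

++-block-∷ʳ-true : ∀ u a b → (u ++ block a b) ∷ʳ true ≡ u ++ block a (suc b)
++-block-∷ʳ-true u a b = trans (++-assoc u (block a b) [ true ]) (cong (u ++_) (block-∷ʳ-true a b))

++-block-∷ʳ-false : ∀ u a → (u ++ block a 0) ∷ʳ false ≡ u ++ block (suc a) 0
++-block-∷ʳ-false u a = trans (++-assoc u (block a 0) [ false ]) (cong (u ++_) (block-∷ʳ-false a))

length-++-block : ∀ u a b → a + b ≤ length (u ++ block a b)
length-++-block u a b = begin
  a + b
    ≡⟨ cong₂ _+_ (length-replicate a) (length-replicate b) ⟨
  length (replicate a false) + length (replicate b true)
    ≡⟨ length-++ (replicate a false) ⟨
  length (block a b)
    ≤⟨ m≤n+m _ (length u) ⟩
  length u + length (block a b)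
    ≡⟨ length-++ u ⟨
  length (u ++ block a b)
    ∎
  where open ≤-Reasoning

-- Automata on words

is-just⇒≢nothing : ∀ {A : Set} {m : Maybe A} → is-just m ≡ true → m ≢ nothing
is-just⇒≢nothing {m = just _} _ ()

≢nothing⇒is-just : ∀ {A : Set} {m : Maybe A} → m ≢ nothing → is-just m ≡ true
≢nothing⇒is-just {m = just _}  _       = refl
≢nothing⇒is-just {m = nothing} m≢nothing = ⊥-elim (m≢nothing refl)

module Automaton {S : Set} (step : S → Bool → Maybe S) where

  step? : Maybe S → Bool → Maybe S
  step? nothing  _ = nothing
  step? (just s) x = step s x

  run : Maybe S → Word → Maybe S
  run = foldl step?

  run-nothing : ∀ w → run nothing w ≡ nothing
  run-nothing []      = refl
  run-nothing (_ ∷ w) = run-nothing w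

  run-++ : ∀ m u v → run m (u ++ v) ≡ run (run m u) v
  run-++ = foldl-++ step?

  run-invariant : (Inv : Word → S → Set) →
                  (∀ {w s x s′} → Inv w s → step s x ≡ just s′ → Inv (w ∷ʳ x) s′) →
                  ∀ v {w s s′} → Inv w s → run (just s) v ≡ just s′ → Inv (w ++ v) s′
  run-invariant Inv preserved []      {w} inv refl = subst (λ z → Inv z _) (sym (++-identityʳ w)) inv
  run-invariant Inv preserved (x ∷ v) {w} {s} inv reached with step s x in stepped
  ... | nothing with () ← trans (sym reached) (run-nothing v)
  ... | just _  = subst (λ z → Inv z _) (++-assoc w [ x ] v)
                        (run-invariant Inv preserved v (preserved inv stepped) reached)

  run-rejects : ∀ w {s} → run (just s) w ≡ nothing →
                ∃[ pre ] ∃[ x ] ∃[ r ] ∃[ s′ ]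
                  w ≡ pre ++ x ∷ r × run (just s) pre ≡ just s′ × step s′ x ≡ nothing
  run-rejects (x ∷ w) {s} rejected with step s x in stepped
  ... | nothing = [] , x , w , s , refl , refl , stepped
  ... | just s₁ with run-rejects w rejected
  ...   | pre , y , r , s′ , refl , reached , stuck =
    x ∷ pre , y , r , s′ , refl , trans (cong (λ m → run m pre) stepped) reached , stuck

  transfer : (Maybe S → ℕ) → Maybe S → ℕ
  transfer wt m = wt (step? m false) + wt (step? m true)

  module _ (start : S) where

    countBy : (Maybe S → ℕ) → ℕ → ℕ
    countBy wt = sumWords (wt ∘ run (just start))

    countBy-suc : ∀ wt n → countBy wt (suc n) ≡ countBy (transfer wt) n
    countBy-suc wt n = begin
      countBy wt (suc n)
        ≡⟨ cong₂ _+_ (appended false) (appended true) ⟩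
      sumWords (reading false) n + sumWords (reading true) n
        ≡⟨ sumWords-+ n (reading false) (reading true) ⟨
      countBy (transfer wt) n
        ∎
      where
      open ≡-Reasoning
      reading : Bool → Word → ℕ
      reading x w = wt (step? (run (just start) w) x)
      appended : ∀ x → sumWords (λ w → wt (run (just start) (w ∷ʳ x))) n ≡ sumWords (reading x) n
      appended x = sumWords-cong n λ w _ → cong wt (foldl-∷ʳ step? (just start) x w)

    countBy-+ : ∀ wt wt′ n → countBy (λ m → wt m + wt′ m) n ≡ countBy wt n + countBy wt′ n
    countBy-+ wt wt′ n = sumWords-+ n _ _

    countBy-cong : ∀ wt wt′ n → (∀ m → wt m ≡ wt′ m) → countBy wt n ≡ countBy wt′ n
    countBy-cong wt wt′ n wt≡wt′ = sumWords-cong n λ w _ → wt≡wt′ _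

    countBy-transfer : ∀ wt wt′ wt″ n → (∀ m → transfer wt m + wt′ m ≡ wt″ m) →
                       countBy wt (suc n) + countBy wt′ n ≡ countBy wt″ n
    countBy-transfer wt wt′ wt″ n sum≡ = begin
      countBy wt (suc n) + countBy wt′ n
        ≡⟨ cong (_+ countBy wt′ n) (countBy-suc wt n) ⟩
      countBy (transfer wt) n + countBy wt′ n
        ≡⟨ countBy-+ (transfer wt) wt′ n ⟨
      countBy (λ m → transfer wt m + wt′ m) n
        ≡⟨ countBy-cong _ wt″ n sum≡ ⟩
      countBy wt″ n
        ∎
      where open ≡-Reasoning

    countBy-cong-reachable :
      (Inv : Word → S → Set) → (∀ {w s x s′} → Inv w s → step s x ≡ just s′ → Inv (w ∷ʳ x) s′) →
      Inv [] start → ∀ wt wt′ n → wt nothing ≡ wt′ nothing →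
      (∀ w s → length w ≡ n → Inv w s → wt (just s) ≡ wt′ (just s)) → countBy wt n ≡ countBy wt′ n
    countBy-cong-reachable Inv preserved initial wt wt′ n dead≡ live≡ =
      sumWords-cong n λ w |w| → agree w |w| (run (just start) w) refl
      where
      agree : ∀ w → length w ≡ n → ∀ m → run (just start) w ≡ m → wt m ≡ wt′ m
      agree w |w| nothing  _       = dead≡
      agree w |w| (just s) reached = live≡ w s |w| (run-invariant Inv preserved w initial reached)

-- A scanner for q-decreasing words

-- ones: no 0 has been read; suffix a b: the input ends with the factor 0^a 1^b,
-- maximal on the left and possibly still growing on the right.
data State : Set where
  ones   : State
  suffix : ℕ → ℕ → State

module QDecreasingAutomaton (p : ℕ) where

  q : ℕ
  q = suc p

  step : State → Bool → Maybe State
  step ones         true  = just ones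
  step ones         false = just (suffix 1 0)
  step (suffix a b) true with suc b <? q * a
  ... | yes _ = just (suffix a (suc b))
  ... | no _  = nothing
  step (suffix a zero)    false = just (suffix (suc a) 0)
  step (suffix a (suc b)) false = just (suffix 1 0)

  open Automaton step public

  Reached : Word → State → Set
  Reached w ones               = ¬ EndsIn0 w
  Reached w (suffix zero b)    = ⊥
  Reached w (suffix (suc a) b) = b < q * suc a × ∃[ u ] w ≡ u ++ block (suc a) b × ¬ EndsIn0 u

  step-Reached : ∀ {w s x s′} → Reached w s → step s x ≡ just s′ → Reached (w ∷ʳ x) s′
  step-Reached {w} {ones} {true}  ¬0w refl = ∷ʳ-true-¬EndsIn0 w
  step-Reached {w} {ones} {false} ¬0w refl = s≤s z≤n , w , refl , ¬0w
  step-Reached {s = suffix (suc a) zero} {false} (_ , u , refl , ¬0u) refl =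
    s≤s z≤n , u , ++-block-∷ʳ-false u (suc a) , ¬0u
  step-Reached {s = suffix (suc a) (suc b)} {false} (_ , u , refl , _) refl =
    s≤s z≤n , u ++ block (suc a) (suc b) , refl ,
    subst (¬_ ∘ EndsIn0) (++-block-∷ʳ-true u (suc a) b) (∷ʳ-true-¬EndsIn0 (u ++ block (suc a) b))
  step-Reached {s = suffix (suc a) b} {true} (_ , u , refl , ¬0u) stepped with suc b <? q * suc a
  ... | yes b+1<qa with refl ← stepped =
    b+1<qa , u , ++-block-∷ʳ-true u (suc a) b , ¬0u

  Reached-run : ∀ w {s} → run (just ones) w ≡ just s → Reached w s
  Reached-run w = run-invariant Reached step-Reached w ¬EndsIn0-[]

  step-false-opens : ∀ {w} s → Reached w s → ¬ EndsIn0 w → step s false ≡ just (suffix 1 0)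
  step-false-opens ones                 _                  _   = refl
  step-false-opens (suffix (suc a) (suc b)) _              _   = refl
  step-false-opens (suffix (suc a) zero) (_ , u , refl , _) ¬0w =
    ⊥-elim (¬0w (u ++ block a 0 , sym (++-block-∷ʳ-false u a)))

  run-zeros : ∀ j k z → run (just (suffix k 0)) (replicate j false ++ z) ≡ run (just (suffix (j + k) 0)) z
  run-zeros zero    k z = refl
  run-zeros (suc j) k z = trans (run-zeros j (suc k) z) (cong (λ i → run (just (suffix i 0)) z) (+-suc j k))

  run-ones : ∀ a c b z → c < q * a → run (just (suffix a c)) (replicate b true ++ z) ≢ nothing → c + b < q * a
  run-ones a c zero    z c<qa _ rewrite +-identityʳ c = c<qa
  run-ones a c (suc b) z _    alive with suc c <? q * a
  ... | yes c+1<qa rewrite +-suc c b = run-ones a (suc c) b z c+1<qa alive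
  ... | no _ = ⊥-elim (alive (run-nothing (replicate b true ++ z)))

  run-block-alive : ∀ s a b v → step s false ≡ just (suffix 1 0) →
                    run (just s) (block (suc a) b ++ v) ≢ nothing → b < q * suc a
  run-block-alive s a b v opens alive = run-ones (suc a) 0 b v (s≤s z≤n) (alive ∘ trans (begin
    run (just s) (false ∷ block a b ++ v)
      ≡⟨ cong (λ m → run m (block a b ++ v)) opens ⟩
    run (just (suffix 1 0)) ((replicate a false ++ replicate b true) ++ v)
      ≡⟨ cong (run (just (suffix 1 0))) (++-assoc (replicate a false) (replicate b true) v) ⟩
    run (just (suffix 1 0)) (replicate a false ++ replicate b true ++ v)
      ≡⟨ run-zeros a 1 (replicate b true ++ v) ⟩
    run (just (suffix (a + 1) 0)) (replicate b true ++ v)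
      ≡⟨ cong (λ i → run (just (suffix i 0)) (replicate b true ++ v)) (+-comm a 1) ⟩
    run (just (suffix (suc a) 0)) (replicate b true ++ v)
      ∎))
    where open ≡-Reasoning

  -- No 0 precedes a maximal factor, so the scan opens a fresh factor at its first 0.
  accepts-sound : ∀ w → run (just ones) w ≢ nothing → QDecreasing q w
  accepts-sound _ alive u v (suc a) b _ refl maximal = reading (run (just ones) u) refl
    where
    alive′ : ∀ {m} → run (just ones) u ≡ m → run m (block (suc a) b ++ v) ≢ nothing
    alive′ {m} reachedU rejected = alive (begin
      run (just ones) (u ++ block (suc a) b ++ v)     ≡⟨ run-++ (just ones) u (block (suc a) b ++ v) ⟩
      run (run (just ones) u) (block (suc a) b ++ v)  ≡⟨ cong (λ m′ → run m′ (block (suc a) b ++ v)) reachedU ⟩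
      run m (block (suc a) b ++ v)                    ≡⟨ rejected ⟩
      nothing                                         ∎)
      where open ≡-Reasoning
    reading : ∀ m → run (just ones) u ≡ m → b < q * suc a
    reading nothing  reachedU = ⊥-elim (alive′ reachedU (run-nothing (block (suc a) b ++ v)))
    reading (just s) reachedU = run-block-alive s a b v opens (alive′ reachedU)
      where
      opens : step s false ≡ just (suffix 1 0)
      opens = step-false-opens s (Reached-run u reachedU) (MaximalOcc⇒¬EndsIn0 {a = a} {b} maximal)

  step-stuck : ∀ {s x} → step s x ≡ nothing →
               ∃[ a ] ∃[ b ] s ≡ suffix a b × x ≡ true × ¬ suc b < q * a
  step-stuck {suffix a b} {true} stuck with suc b <? q * a
  ... | no b+1≮qa = a , b , refl , refl , b+1≮qa
  step-stuck {suffix a zero}    {false} ()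
  step-stuck {suffix a (suc b)} {false} ()

  -- The scan first fails on a 1 that overfills the current factor; extended by the
  -- 1s that follow, that factor is maximal and violates q·a > b.
  accepts-complete : ∀ w → QDecreasing q w → run (just ones) w ≢ nothing
  accepts-complete w qdec rejected with run-rejects w rejected
  ... | pre , x , r , s , refl , reachedPre , stuck with step-stuck {s} {x} stuck | Reached-run pre reachedPre
  ... | suc a , b , refl , refl , b+1≮qa | _ , u , refl , ¬0u with c , r′ , refl , ¬1r′ ← leadingOnes r =
    b+1≮qa (≤-<-trans (s≤s (m≤m+n b c))
                      (qdec u r′ (suc a) (suc (b + c)) (s≤s z≤n) w≡ (block-MaximalOcc ¬0u ¬1r′)))
    where
    w≡ : (u ++ block (suc a) b) ++ true ∷ replicate c true ++ r′ ≡ u ++ block (suc a) (suc (b + c)) ++ r′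
    w≡ = trans (++-block-++-ones u (suc a) b (suc c) r′) (cong (λ k → u ++ block (suc a) k ++ r′) (+-suc b c))

  -- Counting words by the state they reach

  accepted : Maybe State → ℕ
  accepted = indicator ∘ is-just

  saturated : Maybe State → ℕ
  saturated (just (suffix a b)) with suc b <? q * a
  ... | yes _ = 0
  ... | no _  = 1
  saturated _ = 0

  opensBlock : Maybe State → ℕ
  opensBlock (just (suffix a (suc b)))    = 1
  opensBlock (just (suffix (suc a) zero)) = 0
  opensBlock (just _)                     = 1
  opensBlock nothing                      = 0

  at : ℕ → ℕ → Maybe State → ℕ
  at a b (just (suffix a′ b′)) = indicator (does (b ≟ b′) ∧ does (a ≟ a′))
  at a b _                     = 0

  at-here : ∀ a b → at a b (just (suffix a b)) ≡ 1
  at-here a b = cong indicator (cong₂ _∧_ (dec-true (b ≟ b) refl) (dec-true (a ≟ a) refl))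

  at-elsewhere : ∀ {a b a′ b′} → suffix a′ b′ ≢ suffix a b → at a b (just (suffix a′ b′)) ≡ 0
  at-elsewhere {a} {b} {a′} {b′} differs with b ≟ b′ | a ≟ a′
  ... | yes refl | yes refl = ⊥-elim (differs refl)
  ... | _        | no a≢a′  =
    cong indicator (trans (cong (does (b ≟ b′) ∧_) (dec-false (a ≟ a′) a≢a′)) (∧-zeroʳ _))
  ... | no b≢b′  | _        = cong indicator (cong (_∧ does (a ≟ a′)) (dec-false (b ≟ b′) b≢b′))

  transfer-accepted : ∀ m → transfer accepted m + saturated m ≡ accepted m + accepted m
  transfer-accepted nothing                    = refl
  transfer-accepted (just ones)                = refl
  transfer-accepted (just (suffix a zero))    with 1 <? q * a
  ... | yes _ = refl
  ... | no _  = refl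
  transfer-accepted (just (suffix a (suc b))) with suc (suc b) <? q * a
  ... | yes _ = refl
  ... | no _  = refl

  transfer-opensBlock : ∀ m → transfer opensBlock m + saturated m ≡ accepted m
  transfer-opensBlock nothing                    = refl
  transfer-opensBlock (just ones)                = refl
  transfer-opensBlock (just (suffix a zero))    with 1 <? q * a
  ... | yes _ = refl
  ... | no _  = refl
  transfer-opensBlock (just (suffix a (suc b))) with suc (suc b) <? q * a
  ... | yes _ = refl
  ... | no _  = refl

  transfer-at-opening : ∀ m → transfer (at 1 0) m ≡ opensBlock m
  transfer-at-opening nothing                        = refl
  transfer-at-opening (just ones)                    = refl
  transfer-at-opening (just (suffix zero zero))     with 1 <? q * zero
  ... | yes _ = refl
  ... | no _  = refl
  transfer-at-opening (just (suffix (suc a) zero))  with 1 <? q * suc a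
  ... | yes _ = refl
  ... | no _  = refl
  transfer-at-opening (just (suffix a (suc b)))     with suc (suc b) <? q * a
  ... | yes _ = refl
  ... | no _  = refl

  transfer-at-zeros : ∀ a m → transfer (at (suc (suc a)) 0) m ≡ at (suc a) 0 m
  transfer-at-zeros a nothing                       = refl
  transfer-at-zeros a (just ones)                   = refl
  transfer-at-zeros a (just (suffix a′ zero))      with 1 <? q * a′
  ... | yes _ = +-identityʳ _
  ... | no _  = +-identityʳ _
  transfer-at-zeros a (just (suffix a′ (suc b′))) with suc (suc b′) <? q * a′
  ... | yes _ = refl
  ... | no _  = refl

  transfer-at-ones : ∀ a b → suc b < q * a → ∀ m → transfer (at a (suc b)) m ≡ at a b m
  transfer-at-ones a b _ nothing     = refl
  transfer-at-ones a b _ (just ones) = refl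
  transfer-at-ones a b b+1<qa (just (suffix a′ zero)) with 1 <? q * a′
  ... | yes _ = refl
  ... | no 1≮qa′ = sym (at-elsewhere {a} {b} {a′} {0} λ { refl → 1≮qa′ b+1<qa })
  transfer-at-ones a b b+1<qa (just (suffix a′ (suc b′))) with suc (suc b′) <? q * a′
  ... | yes _ = refl
  ... | no b′+2≮qa′ = sym (at-elsewhere {a} {b} {a′} {suc b′} λ { refl → b′+2≮qa′ b+1<qa })

  weighted : (Maybe State → ℕ) → ℕ → ℕ
  weighted = countBy ones

  #accepted #saturated #opening : ℕ → ℕ
  #accepted  = weighted accepted
  #saturated = weighted saturated
  #opening   = weighted opensBlock

  #accepted-suc : ∀ n → #accepted (suc n) + #saturated n ≡ #accepted n + #accepted n
  #accepted-suc n =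
    trans (countBy-transfer ones accepted saturated _ n transfer-accepted) (countBy-+ ones accepted accepted n)

  #opening-suc : ∀ n → #opening (suc n) + #saturated n ≡ #accepted n
  #opening-suc n = countBy-transfer ones opensBlock saturated accepted n transfer-opensBlock

  weighted-at : ∀ a b k → b < q * suc a → weighted (at (suc a) b) (suc (b + (a + k))) ≡ #opening k
  weighted-at a (suc b) k b+1<qa = begin
    weighted (at (suc a) (suc b)) (suc (suc b + (a + k)))
      ≡⟨ countBy-suc ones (at (suc a) (suc b)) (suc (b + (a + k))) ⟩
    weighted (transfer (at (suc a) (suc b))) (suc (b + (a + k)))
      ≡⟨ countBy-cong ones _ (at (suc a) b) (suc (b + (a + k))) (transfer-at-ones (suc a) b b+1<qa) ⟩
    weighted (at (suc a) b) (suc (b + (a + k)))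
      ≡⟨ weighted-at a b k (<-trans (n<1+n b) b+1<qa) ⟩
    #opening k
      ∎
    where open ≡-Reasoning
  weighted-at zero    zero k _ =
    trans (countBy-suc ones (at 1 0) k) (countBy-cong ones _ opensBlock k transfer-at-opening)
  weighted-at (suc a) zero k _ = begin
    weighted (at (suc (suc a)) 0) (suc (suc (a + k)))
      ≡⟨ countBy-suc ones (at (suc (suc a)) 0) (suc (a + k)) ⟩
    weighted (transfer (at (suc (suc a)) 0)) (suc (a + k))
      ≡⟨ countBy-cong ones _ (at (suc a) 0) (suc (a + k)) (transfer-at-zeros a) ⟩
    weighted (at (suc a) 0) (suc (a + k))
      ≡⟨ weighted-at a zero k (s≤s z≤n) ⟩
    #opening k
      ∎
    where open ≡-Reasoning

  weighted-reachable : ∀ wt wt′ n → wt nothing ≡ wt′ nothing → wt (just ones) ≡ wt′ (just ones) →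
                       (∀ a b → b < q * suc a → suc a + b ≤ n →
                                wt (just (suffix (suc a) b)) ≡ wt′ (just (suffix (suc a) b))) →
                       weighted wt n ≡ weighted wt′ n
  weighted-reachable wt wt′ n dead≡ ones≡ suffix≡ =
    countBy-cong-reachable ones Reached step-Reached ¬EndsIn0-[] wt wt′ n dead≡ agree
    where
    agree : ∀ w s → length w ≡ n → Reached w s → wt (just s) ≡ wt′ (just s)
    agree w ones                _    _                    = ones≡
    agree w (suffix (suc a) b) refl (b<qa , u , refl , _) = suffix≡ a b b<qa (length-++-block u (suc a) b)

  weighted-at-short : ∀ a b n → n ≤ a + b → weighted (at (suc a) b) n ≡ 0
  weighted-at-short a b n n≤a+b =
    trans (weighted-reachable (at (suc a) b) (λ _ → 0) n refl refl too-long) (sumWords-zero n)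
    where
    too-long : ∀ a′ b′ → b′ < q * suc a′ → suc a′ + b′ ≤ n → at (suc a) b (just (suffix (suc a′) b′)) ≡ 0
    too-long a′ b′ _ a′+b′<n =
      at-elsewhere {suc a} {b} {suc a′} {b′} λ { refl → <-irrefl refl (≤-trans a′+b′<n n≤a+b) }

  -- q (a + 1) − 1 written without truncated subtraction
  maxOnes : ℕ → ℕ
  maxOnes a = a + p * suc a

  saturatedLength : ℕ → ℕ
  saturatedLength a = suc a + maxOnes a

  saturatedLength-zero : saturatedLength 0 ≡ q
  saturatedLength-zero = cong suc (*-identityʳ p)

  saturatedLength-suc : ∀ a → saturatedLength (suc a) ≡ saturatedLength a + suc q
  saturatedLength-suc a = grows a p
    where
    grows : ∀ a p → suc (suc a) + (suc a + p * suc (suc a)) ≡ suc a + (a + p * suc a) + suc (suc p)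
    grows = solve-∀

  q≤saturatedLength : ∀ a → q ≤ saturatedLength a
  q≤saturatedLength a = s≤s (≤-trans (m≤m*n p (suc a)) (≤-trans (m≤n+m _ a) (m≤n+m _ a)))

  #saturatedAt : ℕ → ℕ → ℕ
  #saturatedAt a = weighted (at (suc a) (maxOnes a))

  #saturatedAt-long : ∀ a k → #saturatedAt a (saturatedLength a + k) ≡ #opening k
  #saturatedAt-long a k =
    trans (cong (#saturatedAt a) (reorder a (maxOnes a) k)) (weighted-at a (maxOnes a) k (n<1+n (maxOnes a)))
    where
    reorder : ∀ a m k → suc a + m + k ≡ suc (m + (a + k))
    reorder = solve-∀

  #saturatedAt-short : ∀ a n → n < saturatedLength a → #saturatedAt a n ≡ 0
  #saturatedAt-short a n n<len = weighted-at-short a (maxOnes a) n (s≤s⁻¹ n<len)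

  #saturatedAt-shift : ∀ a n → #saturatedAt (suc a) (n + suc q) ≡ #saturatedAt a n
  #saturatedAt-shift a n with n <? saturatedLength a
  ... | yes n<len = trans (#saturatedAt-short (suc a) (n + suc q) longer) (sym (#saturatedAt-short a n n<len))
    where
    longer : n + suc q < saturatedLength (suc a)
    longer = subst (n + suc q <_) (sym (saturatedLength-suc a)) (+-monoˡ-< (suc q) n<len)
  ... | no n≮len with k , refl ← m≤n⇒∃[o]m+o≡n (≮⇒≥ n≮len) = begin
    #saturatedAt (suc a) (saturatedLength a + k + suc q)
      ≡⟨ cong (#saturatedAt (suc a)) (xy∙z≈xz∙y (saturatedLength a) k (suc q)) ⟩
    #saturatedAt (suc a) (saturatedLength a + suc q + k)
      ≡⟨ cong (λ l → #saturatedAt (suc a) (l + k)) (saturatedLength-suc a) ⟨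
    #saturatedAt (suc a) (saturatedLength (suc a) + k)
      ≡⟨ #saturatedAt-long (suc a) k ⟩
    #opening k
      ≡⟨ #saturatedAt-long a k ⟨
    #saturatedAt a (saturatedLength a + k)
      ∎
    where open ≡-Reasoning

  #saturated-sum : ∀ N n → n ≤ N → #saturated n ≡ sumBelow (λ a → #saturatedAt a n) N
  #saturated-sum N n n≤N =
    trans (weighted-reachable saturated (λ m → sumBelow (λ a → at (suc a) (maxOnes a) m) N) n
                              (sym (sumBelow-zero N λ _ → refl)) (sym (sumBelow-zero N λ _ → refl)) agree)
          (sumWords-sumBelow N n (λ a w → at (suc a) (maxOnes a) (run (just ones) w)))
    where
    agree : ∀ a b → b < q * suc a → suc a + b ≤ n →
            saturated (just (suffix (suc a) b)) ≡
            sumBelow (λ i → at (suc i) (maxOnes i) (just (suffix (suc a) b))) N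
    agree a b b<qa a+b<n = sym (trans (sumBelow-single N _ a<N elsewhere) atSuffix)
      where
      a<N : a < N
      a<N = ≤-trans (s≤s (m≤m+n a b)) (≤-trans a+b<n n≤N)
      elsewhere : ∀ i → i ≢ a → at (suc i) (maxOnes i) (just (suffix (suc a) b)) ≡ 0
      elsewhere i i≢a = at-elsewhere {suc i} {maxOnes i} {suc a} {b} λ { refl → i≢a refl }
      atSuffix : at (suc a) (maxOnes a) (just (suffix (suc a) b)) ≡ saturated (just (suffix (suc a) b))
      atSuffix with suc b <? q * suc a
      ... | yes b+1<qa = at-elsewhere {suc a} {maxOnes a} {suc a} {b} λ { refl → <-irrefl refl b+1<qa }
      ... | no b+1≮qa with refl ← ≤-antisym (s≤s⁻¹ b<qa) (s≤s⁻¹ (≮⇒≥ b+1≮qa)) =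
        at-here (suc a) (maxOnes a)

  #saturated-short : ∀ n → n < q → #saturated n ≡ 0
  #saturated-short n n<q = trans (#saturated-sum n n ≤-refl)
    (sumBelow-zero n λ a → #saturatedAt-short a n (<-≤-trans n<q (q≤saturatedLength a)))

  #saturated-q : #saturated q ≡ 1
  #saturated-q = begin
    #saturated q
      ≡⟨ #saturated-sum q q ≤-refl ⟩
    #saturatedAt 0 q + sumBelow (λ a → #saturatedAt (suc a) q) p
      ≡⟨ cong₂ _+_ first (sumBelow-zero p rest) ⟩
    1 + 0
      ∎
    where
    open ≡-Reasoning
    first : #saturatedAt 0 q ≡ 1
    first = trans (cong (#saturatedAt 0) (trans (sym saturatedLength-zero) (sym (+-identityʳ _))))
                  (#saturatedAt-long 0 0)
    rest : ∀ a → #saturatedAt (suc a) q ≡ 0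
    rest a = #saturatedAt-short (suc a) q (subst (q <_) (sym (saturatedLength-suc a))
                                            (≤-<-trans (q≤saturatedLength a) (m<m+n _ (s≤s z≤n))))

  #saturated-shift : ∀ n → #saturated (n + suc q) ≡ #accepted n
  #saturated-shift n = begin
    #saturated (n + suc q)
      ≡⟨ #saturated-sum (suc (n + q)) (n + suc q) (≤-reflexive (+-suc n q)) ⟩
    #saturatedAt 0 (n + suc q) + sumBelow (λ a → #saturatedAt (suc a) (n + suc q)) (n + q)
      ≡⟨ cong₂ _+_ first (sumBelow-cong (n + q) λ a → #saturatedAt-shift a n) ⟩
    #opening (suc n) + sumBelow (λ a → #saturatedAt a n) (n + q)
      ≡⟨ cong (_+_ (#opening (suc n))) (#saturated-sum (n + q) n (m≤m+n n q)) ⟨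
    #opening (suc n) + #saturated n
      ≡⟨ #opening-suc n ⟩
    #accepted n
      ∎
    where
    open ≡-Reasoning
    first : #saturatedAt 0 (n + suc q) ≡ #opening (suc n)
    first = trans (cong (#saturatedAt 0) length≡) (#saturatedAt-long 0 (suc n))
      where
      length≡ : n + suc q ≡ saturatedLength 0 + suc n
      length≡ = trans (+-comm n (suc q)) (trans (sym (+-suc q n)) (cong (_+ suc n) (sym saturatedLength-zero)))

  IsCountQDec⇒≡#accepted : ∀ n k → IsCountQDec q n k → k ≡ #accepted n
  IsCountQDec⇒≡#accepted n k (L , uniqueL , L⇔ , refl) =
    trans (length-unique-≡ uniqueL (wordsSatisfying-unique n accepts) (mk⇔ toAccepted fromAccepted))
          (length-wordsSatisfying n accepts)
    where
    accepts : Word → Bool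
    accepts w = is-just (run (just ones) w)
    toAccepted : ∀ {w} → w ∈ L → w ∈ wordsSatisfying accepts n
    toAccepted {w} w∈L with |w| , qdec ← Equivalence.to (L⇔ w) w∈L =
      ∈-wordsSatisfying⁺ n accepts |w| (≢nothing⇒is-just (accepts-complete w qdec))
    fromAccepted : ∀ {w} → w ∈ wordsSatisfying accepts n → w ∈ L
    fromAccepted {w} w∈ with |w| , acc ← ∈-wordsSatisfying⁻ n accepts w∈ =
      Equivalence.from (L⇔ w) (|w| , accepts-sound w (is-just⇒≢nothing acc))

corollary2 : (q : ℕ) → 1 ≤ q → (f : ℕ → ℕ) → (∀ n → IsCountQDec q n (f n)) →
    ∀ n → ((λ k → + f k) ⊛ denom q) n ≡ numer q n
corollary2 (suc p) _ f isCount n = begin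
  (ofℕ f ⊛ denom q) n
    ≡⟨ ⊛-congˡ (denom q) n (λ k → cong +_ (IsCountQDec⇒≡#accepted k (f k) (isCount k))) ⟩
  (ofℕ #accepted ⊛ denom q) n
    ≡⟨ series-from-recurrence q #accepted #saturated refl #accepted-suc saturated-series n ⟩
  numer q n
    ∎
  where
  open ≡-Reasoning
  open QDecreasingAutomaton p
  saturated-series : ∀ n → + #saturated n ≡ mono q n ℤ.+ (ofℕ #accepted ⊛ mono (q + 1)) n
  saturated-series = shifted-series q #accepted #saturated #saturated-short #saturated-q #saturated-shift
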